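{- Let $\mathcal{S}$ be a string of length $n$, with PSS tree, next smaller suffix array $\mathrm{nss}$ and Lyndon array $\lambda$. For every $i\in[1,n]$, $\mathrm{nss}[i]=i+\mathrm{subtreesize}(i)$, and hence $\lambda[i]=\mathrm{subtreesize}(i)$, where $\mathrm{subtreesize}(i)$ is the number of nodes in the subtree of the PSS tree rooted at $i$ (including $i$).
   Context: $\mathcal{S}_k=\mathcal{S}[k..n]$; suffixes compared lexicographically (a proper prefix is smaller); $\mathcal{S}_0$ and $\mathcal{S}_{n+1}$ are artificial suffixes (sentinel $\$$ smaller than all symbols) that are smaller than every $\mathcal{S}_k$, $k\in[1,n]$. $\mathrm{nss}[i]=\min\{j\in(i,n+1]:\mathcal{S}_i\succ\mathcal{S}_j\}$, $\mathrm{pss}[i]=\max\{j\in[0,i):\mathcal{S}_j\prec\mathcal{S}_i\}$. The PSS tree is the ordinal tree on nodes $0,\dots,n$ with root $0$ and parent of $i\in[1,n]$ equal to $\mathrm{pss}[i]$, children ordered by increasing index. A Lyndon word is a non-empty string strictly smaller than each of its proper non-empty suffixes; $\lambda[i]=\max\{\ell:\mathcal{S}[i..i+\ell-1]\text{ is a Lyndon word}\}$. -}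

module Defs where

open import Level using (Level; _⊔_)
open import Data.Nat using (ℕ; zero; suc; _+_; _∸_; _≤_; _<_)
open import Data.List using (List; []; _∷_; length; drop; take)
open import Data.List.Membership.Propositional using (_∈_)
open import Data.List.Relation.Unary.Unique.Propositional using (Unique)
open import Data.List.Relation.Binary.Lex.Core using (Lex-<)
open import Data.Product using (Σ; _×_; _,_)
open import Data.Sum using (_⊎_)
open import Relation.Nullary using (¬_)
open import Relation.Binary.PropositionalEquality using (_≡_)
open import Relation.Binary.Bundles using (StrictTotalOrder)

module _ {a ℓ₁ ℓ₂ : Level} (O : StrictTotalOrder a ℓ₁ ℓ₂) where
  open StrictTotalOrder O using (_≈_) renaming (Carrier to A; _<_ to _<ₐ_)

  -- lexicographic strict order on strings (a proper prefix is smaller)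
  _≺ˡ_ : List A → List A → Set (a ⊔ ℓ₁ ⊔ ℓ₂)
  _≺ˡ_ = Lex-< _≈_ _<ₐ_

  module _ (S : List A) where
    -- n = length S ; positions are 1-based
    -- suffix k = S[k..n] for k ∈ [1, n+1]  (suffix (n+1) is the empty string)
    suffix : ℕ → List A
    suffix k = drop (k ∸ 1) S

    -- SufLt i j : S_i ≺ S_j, for indices in [0, n+1];
    -- S_0 is the artificial suffix smaller than every S_k, k ∈ [1,n];
    -- S_{n+1} is empty (the sentinel $), hence smaller than every S_k, k ∈ [1,n].
    SufLt : ℕ → ℕ → Set (a ⊔ ℓ₁ ⊔ ℓ₂)
    SufLt i j =
      (i ≡ 0 × 1 ≤ j × j ≤ length S)
      ⊎ (1 ≤ i × 1 ≤ j × suffix i ≺ˡ suffix j)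

    IsNSS : ℕ → ℕ → Set (a ⊔ ℓ₁ ⊔ ℓ₂)
    IsNSS i j = i < j × j ≤ suc (length S) × SufLt j i
              × (∀ k → i < k → k < j → ¬ SufLt k i)

    IsPSS : ℕ → ℕ → Set (a ⊔ ℓ₁ ⊔ ℓ₂)
    IsPSS i j = j < i × SufLt j i
              × (∀ k → j < k → k < i → ¬ SufLt k i)

    -- PSS tree on nodes 0..n, root 0, parent of i ∈ [1,n] is pss[i].
    -- Desc i j : j is in the subtree rooted at i (including i itself).
    data Desc (i : ℕ) : ℕ → Set (a ⊔ ℓ₁ ⊔ ℓ₂) where
      here  : Desc i i
      child : ∀ {j k} → 1 ≤ j → j ≤ length S → IsPSS j k → Desc i k → Desc i j

    SubtreeSize : ℕ → ℕ → Set (a ⊔ ℓ₁ ⊔ ℓ₂)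
    SubtreeSize i s =
      Σ (List ℕ) λ L → Unique L × length L ≡ s
        × (∀ j → (j ∈ L → j ≤ length S × Desc i j)
                × (j ≤ length S → Desc i j → j ∈ L))

    IsLyndon : List A → Set (a ⊔ ℓ₁ ⊔ ℓ₂)
    IsLyndon w = 1 ≤ length w
               × (∀ m → 1 ≤ m → m < length w → w ≺ˡ drop m w)

    IsLyndonLen : ℕ → ℕ → Set (a ⊔ ℓ₁ ⊔ ℓ₂)
    IsLyndonLen i ℓ = (i + ℓ ≤ suc (length S) × IsLyndon (take ℓ (suffix i)))
                    × (∀ ℓ' → i + ℓ' ≤ suc (length S) → IsLyndon (take ℓ' (suffix i)) → ℓ' ≤ ℓ)

module Submission where

-- Let q = nss[i]: every suffix starting strictly between i and q is larger than 𝒮_i, and 𝒮_q is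
-- smaller. So for i < j < q, 𝒮_i is a previous smaller suffix of 𝒮_j, whence pss[j] ∈ [i, j) and
-- the parent chain of j stays in [i, q) until it reaches i. Conversely a child j of a node k ∈ [i, q)
-- cannot lie at or beyond q: 𝒮_q < 𝒮_i ≤ 𝒮_k < 𝒮_j, so j = q is impossible and for j > q the suffix
-- 𝒮_q would be a closer previous smaller suffix. Hence the subtree of i is [i, q). The same two facts
-- make every proper suffix of 𝒮[i..q-1] larger than the word itself, while every longer prefix of 𝒮_i
-- has a proper suffix starting at q that is smaller than it.

open import Defs
open import Level using (Level; _⊔_)
open import Data.Nat using (ℕ; zero; suc; _+_; _∸_; _≤_; _<_; z≤n; s≤s; s≤s⁻¹; _≤?_)
open import Data.Nat.Properties
open import Data.Nat.Induction using (<-wellFounded)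
open import Data.List using (List; []; _∷_; length; take; drop; applyUpTo)
open import Data.List.Properties
  using (length-take; take-take; take-drop; drop-drop; length-drop; drop-all; length-applyUpTo)
open import Data.List.Membership.Propositional using (_∈_)
open import Data.List.Membership.Propositional.Properties using (∈-applyUpTo⁺; ∈-applyUpTo⁻)
open import Data.List.Relation.Unary.Unique.Propositional.Properties using (applyUpTo⁺₁)
open import Data.List.Relation.Binary.Lex.Core using (base; halt; this; next)
open import Data.List.Relation.Binary.Pointwise.Base using ([]; _∷_)
open import Data.List.Relation.Binary.Pointwise.Properties using (Pointwise-length)
import Data.List.Relation.Binary.Lex.Strict as LexStrict
open import Data.Product using (Σ; _×_; _,_; proj₁)
open import Data.Sum using (_⊎_; inj₁; inj₂; [_,_]′)
open import Function using (_∘_)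
open import Induction.WellFounded using (Acc; acc)
open import Relation.Nullary using (¬_; yes; no; contradiction)
open import Relation.Unary using (Pred; Decidable)
open import Relation.Binary.PropositionalEquality using (_≡_; _≢_; refl; sym; trans; cong; subst)
open import Relation.Binary.Bundles using (StrictTotalOrder)
open import Relation.Binary.Definitions using (tri<; tri≈; tri>)

least : ∀ {ℓ} {P : Pred ℕ ℓ} → Decidable P → ∀ {d} → P d
      → Σ ℕ λ m → m ≤ d × P m × (∀ {k} → k < m → ¬ P k)
least P? Pd with P? 0
... | yes P0 = 0 , z≤n , P0 , λ ()
least P? {zero}  Pd | no ¬P0 = contradiction Pd ¬P0
least {P = P} P? {suc d} Pd | no ¬P0 with least (P? ∘ suc) Pd
... | m , m≤d , Pm , below = suc m , s≤s m≤d , Pm , below-suc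
  where
  below-suc : ∀ {k} → k < suc m → ¬ P k
  below-suc {zero}  _         = ¬P0
  below-suc {suc k} (s≤s k<m) = below k<m

greatest : ∀ {ℓ} {P : Pred ℕ ℓ} → Decidable P → ∀ {b e} → b < e → P b
         → Σ ℕ λ m → b ≤ m × m < e × P m × (∀ {k} → m < k → k < e → ¬ P k)
greatest {P = P} P? {b} {suc e} b<1+e Pb with P? e
... | yes Pe = e , s≤s⁻¹ b<1+e , ≤-refl , Pe , λ e<k k<1+e → contradiction (s≤s⁻¹ k<1+e) (<⇒≱ e<k)
... | no ¬Pe with m≤n⇒m<n∨m≡n (s≤s⁻¹ b<1+e)
...   | inj₂ refl = contradiction Pb ¬Pe
...   | inj₁ b<e with greatest P? b<e Pb
...     | m , b≤m , m<e , Pm , above = m , b≤m , m<n⇒m<1+n m<e , Pm , λ m<k k<1+e →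
  [ above m<k , (λ k≡e → subst (¬_ ∘ P) (sym k≡e) ¬Pe) ]′ (m≤n⇒m<n∨m≡n (s≤s⁻¹ k<1+e))

module LexPrefix {a ℓ₁ ℓ₂} (O : StrictTotalOrder a ℓ₁ ℓ₂) where
  open StrictTotalOrder O using (Carrier; irrefl)
  open StrictTotalOrder (LexStrict.<-strictTotalOrder O) public
    using (compare)
    renaming (_<?_ to _<ₗ?_; _<_ to _<ₗ_; _≈_ to _≋_; trans to <ₗ-trans; asym to <ₗ-asym; <-respʳ-≈ to <ₗ-respʳ-≋)

  private
    length-take≤ : ∀ k (x : List Carrier) → length (take k x) ≤ k
    length-take≤ k x = subst (_≤ k) (sym (length-take k x)) (m⊓n≤m k (length x))

    take-take-≤ : ∀ {k m} {x : List Carrier} → k ≤ m → take k (take m x) ≡ take k x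
    take-take-≤ {k} {m} {x} k≤m = trans (take-take k m x) (cong (λ t → take t x) (m≤n⇒m⊓n≡m k≤m))

  []<ₗ : ∀ {x : List Carrier} → 0 < length x → [] <ₗ x
  []<ₗ {_ ∷ _} _ = halt

  <⇒take<⊎take≋ : ∀ {x y} → x <ₗ y → ∀ k → take k x <ₗ take k y ⊎ take k x ≋ take k y
  <⇒take<⊎take≋ _              zero    = inj₂ []
  <⇒take<⊎take≋ (base ())      (suc k)
  <⇒take<⊎take≋ halt           (suc k) = inj₁ halt
  <⇒take<⊎take≋ (this x<y)     (suc k) = inj₁ (this x<y)
  <⇒take<⊎take≋ (next x≈y x<y) (suc k) with <⇒take<⊎take≋ x<y k
  ... | inj₁ lt = inj₁ (next x≈y lt)
  ... | inj₂ eq = inj₂ (x≈y ∷ eq)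

  take≋⇒drop< : ∀ {x y} k → x <ₗ y → take k x ≋ take k y → drop k x <ₗ drop k y
  take≋⇒drop< zero    x<y            _         = x<y
  take≋⇒drop< (suc k) (base ())      _
  take≋⇒drop< (suc k) halt           ()
  take≋⇒drop< (suc k) (this x<y)     (x≈y ∷ _) = contradiction x<y (irrefl x≈y)
  take≋⇒drop< (suc k) (next _ xs<ys) (_ ∷ eq)  = take≋⇒drop< k xs<ys eq

  take<⇒< : ∀ {k w v} → length v ≤ k → take k w <ₗ v → w <ₗ v
  take<⇒< {zero}  {v = []}        _         (base ())
  take<⇒< {suc k} {[]}            _         lt          = lt
  take<⇒< {suc k} {_ ∷ _} {_ ∷ _} _         (this p)    = this p
  take<⇒< {suc k} {_ ∷ _} {_ ∷ _} (s≤s v≤k) (next e lt) = next e (take<⇒< v≤k lt)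

  <take⇒<take : ∀ {k m x y} → k ≤ m → y <ₗ take k x → y <ₗ take m x
  <take⇒<take z≤n (base ())
  <take⇒<take {x = []}    (s≤s _)   lt          = lt
  <take⇒<take {x = _ ∷ _} (s≤s _)   halt        = halt
  <take⇒<take {x = _ ∷ _} (s≤s _)   (this p)    = this p
  <take⇒<take {x = _ ∷ _} (s≤s k≤m) (next e lt) = next e (<take⇒<take k≤m lt)

  ≮take : ∀ k {x} → ¬ x <ₗ take k x
  ≮take zero    {[]}    (base ())
  ≮take zero    {_ ∷ _} ()
  ≮take (suc k) {[]}    (base ())
  ≮take (suc k) {_ ∷ _} (this p)    = irrefl (StrictTotalOrder.Eq.refl O) p
  ≮take (suc k) {_ ∷ _} (next _ lt) = ≮take k lt

  prefix<suffix-of-prefix : ∀ {x s t}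
    → (∀ {r} → 0 < r → r < s → x <ₗ drop r x) → drop s x <ₗ x
    → 0 < t → t < s → take s x <ₗ drop t (take s x)
  prefix<suffix-of-prefix {x} {t = t} larger smaller 0<t t<s
    with u , refl ← m≤n⇒∃[o]m+o≡n (<⇒≤ t<s)
    rewrite sym (take-drop u t x)
    with <⇒take<⊎take≋ (larger 0<t t<s) u
  ... | inj₁ lt = take<⇒< (length-take≤ u (drop t x))
                    (subst (_<ₗ take u (drop t x)) (sym (take-take-≤ (m≤n+m u t))) lt)
  -- If the suffix at t starts with the length-u prefix of x, comparing what follows gives
  -- drop u x < drop (t + u) x < x, against x < drop u x.
  ... | inj₂ eq = contradiction (larger 0<u (m<n+m u 0<t)) (<ₗ-asym (<ₗ-trans drop-u<drop-t+u smaller))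
    where
    0<u : 0 < u
    0<u = +-cancelˡ-< t 0 u (subst (_< t + u) (sym (+-identityʳ t)) t<s)
    drop-u<drop-t+u : drop u x <ₗ drop (t + u) x
    drop-u<drop-t+u = subst (drop u x <ₗ_) (drop-drop t u x) (take≋⇒drop< u (larger 0<t t<s) eq)

  prefix≮suffix-of-prefix : ∀ {x s ℓ} → s ≤ ℓ → drop s x <ₗ x → ¬ take ℓ x <ₗ drop s (take ℓ x)
  prefix≮suffix-of-prefix {x} {s} s≤ℓ smaller
    with u , refl ← m≤n⇒∃[o]m+o≡n s≤ℓ
    rewrite sym (take-drop u s x)
    with <⇒take<⊎take≋ smaller u
  ... | inj₁ lt = λ hyp → <ₗ-asym hyp (<take⇒<take (m≤n+m u s) lt)
  ... | inj₂ eq = λ hyp →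
    ≮take u (subst (take (s + u) x <ₗ_) (sym (take-take-≤ (m≤n+m u s))) (<ₗ-respʳ-≋ eq hyp))

module PSSTree {a ℓ₁ ℓ₂} (O : StrictTotalOrder a ℓ₁ ℓ₂) (S : List (StrictTotalOrder.Carrier O)) where
  open StrictTotalOrder O using (Carrier)
  open LexPrefix O

  n : ℕ
  n = length S

  -- Indices are shifted by one: D p is definitionally suffix O S (suc p).
  D : ℕ → List Carrier
  D p = drop p S

  D-distinct : ∀ {p r} → p ≢ r → p ≤ n → r ≤ n → D p <ₗ D r ⊎ D r <ₗ D p
  D-distinct {p} {r} p≢r p≤n r≤n with compare (D p) (D r)
  ... | tri< lt _ _ = inj₁ lt
  ... | tri> _ _ gt = inj₂ gt
  ... | tri≈ _ eq _ = contradiction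
    (∸-cancelˡ-≡ p≤n r≤n (trans (sym (length-drop p S)) (trans (Pointwise-length eq) (length-drop r S))))
    p≢r

  D-n<D : ∀ {p} → p < n → D n <ₗ D p
  D-n<D {p} p<n rewrite drop-all n S ≤-refl =
    []<ₗ (subst (0 <_) (sym (length-drop p S)) (m<n⇒0<n∸m p<n))

  length-take-D : ∀ {p t} → p + t ≤ n → length (take t (D p)) ≡ t
  length-take-D {p} {t} p+t≤n = trans (length-take t (D p)) (m≤n⇒m⊓n≡m t≤|Dp|)
    where
    t≤|Dp| : t ≤ length (D p)
    t≤|Dp| = subst (t ≤_) (sym (length-drop p S)) (m+n≤o⇒m≤o∸n t (subst (_≤ n) (+-comm p t) p+t≤n))

  sufLt⇒<ₗ : ∀ {k r} → SufLt O S (suc k) (suc r) → D k <ₗ D r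
  sufLt⇒<ₗ (inj₁ (() , _))
  sufLt⇒<ₗ (inj₂ (_ , _ , lt)) = lt

  <ₗ⇒sufLt : ∀ {k r} → D k <ₗ D r → SufLt O S (suc k) (suc r)
  <ₗ⇒sufLt lt = inj₂ (s≤s z≤n , s≤s z≤n , lt)

  noneSmaller⇒¬SufLt : ∀ {lo hi r} → (∀ {k} → lo < k → k < hi → ¬ D k <ₗ D r)
                     → ∀ k → suc lo < k → k < suc hi → ¬ SufLt O S k (suc r)
  noneSmaller⇒¬SufLt none (suc k) (s≤s lo<k) (s≤s k<hi) lt = none lo<k k<hi (sufLt⇒<ₗ lt)

  pssAbove : ∀ {p r} → p < r → D p <ₗ D r → Σ ℕ λ k → p ≤ k × k < r × IsPSS O S (suc r) (suc k)
  pssAbove {r = r} p<r Dp<Dr with greatest (λ k → D k <ₗ? D r) p<r Dp<Dr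
  ... | k , p≤k , k<r , Dk<Dr , none =
    k , p≤k , k<r , s≤s k<r , <ₗ⇒sufLt Dk<Dr , noneSmaller⇒¬SufLt none

  -- NextSmaller p s says that nss[p + 1] = p + 1 + s.
  record NextSmaller (p s : ℕ) : Set (a ⊔ ℓ₁ ⊔ ℓ₂) where
    constructor nextSmallerAt
    field
      bounded : p + s ≤ n
      smaller : D (p + s) <ₗ D p
      larger  : ∀ {r} → p < r → r < p + s → D p <ₗ D r

  nextSmaller : ∀ {p} → p < n → Σ ℕ (NextSmaller p)
  nextSmaller {p} p<n
    with least (λ e → D (p + e) <ₗ? D p) (subst (λ t → D t <ₗ D p) (sym (m+[n∸m]≡n (<⇒≤ p<n))) (D-n<D p<n))
  ... | s , s≤n∸p , smaller , notBefore = s , nextSmallerAt bounded smaller larger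
    where
    bounded : p + s ≤ n
    bounded = subst (p + s ≤_) (m+[n∸m]≡n (<⇒≤ p<n)) (+-monoʳ-≤ p s≤n∸p)
    larger : ∀ {r} → p < r → r < p + s → D p <ₗ D r
    larger {r} p<r r<p+s with e , refl ← m≤n⇒∃[o]m+o≡n (<⇒≤ p<r)
      with D-distinct (<⇒≢ p<r) (<⇒≤ p<n) (≤-trans (<⇒≤ r<p+s) bounded)
    ... | inj₁ lt = lt
    ... | inj₂ gt = contradiction gt (notBefore (+-cancelˡ-< p e s r<p+s))

  module Subtree {p s} (nss : NextSmaller p s) where
    open NextSmaller nss public

    0<s : 0 < s
    0<s = n≢0⇒n>0 λ s≡0 → <ₗ-asym (Dp<Dp s≡0) (Dp<Dp s≡0)
      where
      Dp<Dp : s ≡ 0 → D p <ₗ D p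
      Dp<Dp s≡0 = subst (λ t → D t <ₗ D p) (trans (cong (p +_) s≡0) (+-identityʳ p)) smaller

    isNSS : IsNSS O S (suc p) (suc p + s)
    isNSS = s≤s (m<m+n p 0<s) , s≤s bounded , <ₗ⇒sufLt smaller
          , noneSmaller⇒¬SufLt (λ p<k k<p+s → <ₗ-asym (larger p<k k<p+s))

    interval⇒desc : ∀ {r} → Acc _<_ r → p ≤ r → r < p + s → Desc O S (suc p) (suc r)
    interval⇒desc (acc below) p≤r r<p+s with m≤n⇒m<n∨m≡n p≤r
    ... | inj₂ refl = here
    ... | inj₁ p<r with pssAbove p<r (larger p<r r<p+s)
    ...   | k , p≤k , k<r , pss =
      child (s≤s z≤n) (≤-trans r<p+s bounded) pss (interval⇒desc (below k<r) p≤k (<-trans k<r r<p+s))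

    D-p≤-trans : ∀ {k x} → p ≤ k → k < p + s → D k <ₗ x → D p <ₗ x
    D-p≤-trans p≤k k<p+s Dk<x with m≤n⇒m<n∨m≡n p≤k
    ... | inj₁ p<k = <ₗ-trans (larger p<k k<p+s) Dk<x
    ... | inj₂ refl = Dk<x

    child-inside : ∀ {k j} → p ≤ k → k < p + s → IsPSS O S (suc j) (suc k) → j < p + s
    child-inside {j = j} p≤k k<p+s (_ , Dk<Dj , none)
      with <-cmp j (p + s) | D-p≤-trans p≤k k<p+s (sufLt⇒<ₗ Dk<Dj)
    ... | tri< j<p+s _ _ | _     = j<p+s
    ... | tri≈ _ refl _  | Dp<Dj = contradiction smaller (<ₗ-asym Dp<Dj)
    ... | tri> _ _ p+s<j | Dp<Dj =
      contradiction (<ₗ⇒sufLt (<ₗ-trans smaller Dp<Dj)) (none (suc (p + s)) (s≤s k<p+s) (s≤s p+s<j))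

    desc⇒interval : ∀ {j} → Desc O S (suc p) j → suc p ≤ j × j < suc p + s
    desc⇒interval here = ≤-refl , s≤s (m<m+n p 0<s)
    desc⇒interval (child {zero} () _ _ _)
    desc⇒interval (child {suc j} {zero} _ _ _ d) with desc⇒interval d
    ... | () , _
    desc⇒interval (child {suc j} {suc k} _ _ pss d) with desc⇒interval d
    ... | s≤s p≤k , s≤s k<p+s = ≤-trans (s≤s p≤k) (<⇒≤ (proj₁ pss)) , s≤s (child-inside p≤k k<p+s pss)

    subtreeSize : SubtreeSize O S (suc p) s
    subtreeSize = applyUpTo (suc p +_) s
                , applyUpTo⁺₁ (suc p +_) s (λ i<j _ → <⇒≢ (+-monoʳ-< (suc p) i<j))
                , length-applyUpTo (suc p +_) s
                , λ j → node⇒desc , desc⇒node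
      where
      node⇒desc : ∀ {j} → j ∈ applyUpTo (suc p +_) s → j ≤ n × Desc O S (suc p) j
      node⇒desc j∈ with e , e<s , refl ← ∈-applyUpTo⁻ (suc p +_) j∈ =
        ≤-trans (+-monoʳ-< p e<s) bounded , interval⇒desc (<-wellFounded (p + e)) (m≤m+n p e) (+-monoʳ-< p e<s)
      desc⇒node : ∀ {j} → j ≤ n → Desc O S (suc p) j → j ∈ applyUpTo (suc p +_) s
      desc⇒node _ d with desc⇒interval d
      ... | 1+p≤j , j<1+p+s with e , refl ← m≤n⇒∃[o]m+o≡n 1+p≤j =
        ∈-applyUpTo⁺ (suc p +_) (+-cancelˡ-< (suc p) e s j<1+p+s)

    D-smaller : drop s (D p) <ₗ D p
    D-smaller = subst (_<ₗ D p) (sym (drop-drop p s S)) smaller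

    D-larger : ∀ {t} → 0 < t → t < s → D p <ₗ drop t (D p)
    D-larger {t} 0<t t<s = subst (D p <ₗ_) (sym (drop-drop p t S)) (larger (m<m+n p 0<t) (+-monoʳ-< p t<s))

    lyndon : IsLyndon O S (take s (D p))
    lyndon = subst (1 ≤_) (sym |w|≡s) 0<s , λ t 0<t t<|w| →
      prefix<suffix-of-prefix D-larger D-smaller 0<t (subst (t <_) |w|≡s t<|w|)
      where
      |w|≡s : length (take s (D p)) ≡ s
      |w|≡s = length-take-D bounded

    lyndon-maximal : ∀ ℓ → suc p + ℓ ≤ suc n → IsLyndon O S (take ℓ (D p)) → ℓ ≤ s
    lyndon-maximal ℓ p+ℓ<1+n (_ , larger-suffixes) with ℓ ≤? s
    ... | yes ℓ≤s = ℓ≤s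
    ... | no ℓ≰s = contradiction
      (larger-suffixes s 0<s (subst (s <_) (sym (length-take-D (s≤s⁻¹ p+ℓ<1+n))) (≰⇒> ℓ≰s)))
      (prefix≮suffix-of-prefix (<⇒≤ (≰⇒> ℓ≰s)) D-smaller)

mainTheorem4 : {a ℓ₁ ℓ₂ : Level} (O : StrictTotalOrder a ℓ₁ ℓ₂)
    → (S : List (StrictTotalOrder.Carrier O))
    → (i : ℕ) → 1 ≤ i → i ≤ length S
    → Σ ℕ λ s → SubtreeSize O S i s × IsNSS O S i (i + s) × IsLyndonLen O S i s
mainTheorem4 O S (suc p) _ p<n with PSSTree.nextSmaller O S p<n
... | s , nss = s , subtreeSize , isNSS , (s≤s bounded , lyndon) , lyndon-maximal
  where
  open PSSTree.Subtree O S nss
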